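{- Let $1\leq k\leq n$ and let $G$ be an acyclic graph on $n$ vertices with exactly $k$ connected components. Then $$F(G)\leq 2^{n-k}+n-1,$$ with equality if and only if $G$ is isomorphic to $(k-1)K_1\cup K_{1,n-k}$.
   Context: All graphs are finite, simple and undirected. A connected subgraph of a graph $G=(V,E)$ is a graph $(V',E')$ with $\emptyset\neq V'\subseteq V$, $E'\subseteq E$, every edge of $E'$ having both endpoints in $V'$, and $(V',E')$ connected; distinct pairs $(V',E')$ are counted separately. The core index $F(G)$ is the number of connected subgraphs of $G$ (for a disconnected graph it is the sum over its components). $K_{1,m}$ is the star with $m$ leaves ($K_{1,0}=K_1$), $\cup$ denotes disjoint union and $mG$ the disjoint union of $m$ copies of $G$. -}

module Defs where

open import Data.Nat using (ℕ; zero; suc; _+_; _∸_; _≡ᵇ_; _≤ᵇ_)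
open import Data.Bool using (Bool; true; false; _∧_; _∨_)
open import Data.Fin using (Fin; toℕ; zero; suc; inject₁; fromℕ)
open import Data.Fin.Subset using (Subset; _∈_; Nonempty)
open import Data.Vec using (Vec; lookup)
open import Data.Product using (Σ; ∃; _×_; _,_)
open import Relation.Binary.PropositionalEquality using (_≡_)
open import Relation.Nullary using (¬_)
open import Function.Bundles using (_↔_; Inverse)
open import Function.Definitions using (Injective)

Graph : ℕ → Set
Graph n = Fin n → Fin n → Bool

IsSimple : ∀ {n} → Graph n → Set
IsSimple {n} G = (∀ (i j : Fin n) → G i j ≡ G j i) × (∀ (i : Fin n) → G i i ≡ false)

data Walk {n} (R : Fin n → Fin n → Bool) : Fin n → Fin n → Set where
  here : ∀ {u} → Walk R u u
  step : ∀ {u w v} → R u w ≡ true → Walk R w v → Walk R u v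

HasSize : ∀ {A : Set} → (A → Set) → ℕ → Set
HasSize {A} P m =
  Σ (Fin m → A) λ f →
    Injective _≡_ _≡_ f × (∀ i → P (f i)) × (∀ a → P a → ∃ λ i → f i ≡ a)

IsComponent : ∀ {n} → Graph n → Subset n → Set
IsComponent {n} G C =
  Nonempty C
  × (∀ (u v : Fin n) → u ∈ C → G u v ≡ true → v ∈ C)
  × (∀ (u v : Fin n) → u ∈ C → v ∈ C → Walk G u v)

NumComponents : ∀ {n} → Graph n → ℕ → Set
NumComponents G k = HasSize (IsComponent G) k

-- A cycle of length l+3: injective sequence of vertices, consecutive ones adjacent,
-- last adjacent to first.
Cycle : ∀ {n} → Graph n → Set
Cycle {n} G =
  Σ ℕ λ l → Σ (Fin (suc (suc (suc l))) → Fin n) λ c →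
    Injective _≡_ _≡_ c
    × (∀ (i : Fin (suc (suc l))) → G (c (inject₁ i)) (c (suc i)) ≡ true)
    × (G (c (fromℕ (suc (suc l)))) (c zero) ≡ true)

Acyclic : ∀ {n} → Graph n → Set
Acyclic G = ¬ Cycle G

-- A subgraph (V', E') : V' a vertex subset, E' an edge subset given as a
-- symmetric Boolean adjacency matrix contained in G with endpoints in V'.
SubgraphData : ℕ → Set
SubgraphData n = Subset n × Vec (Subset n) n

edgeOf : ∀ {n} → Vec (Subset n) n → Fin n → Fin n → Bool
edgeOf E u v = lookup (lookup E u) v

IsConnectedSubgraph : ∀ {n} → Graph n → SubgraphData n → Set
IsConnectedSubgraph {n} G (V , E) =
  (∀ (u v : Fin n) → edgeOf E u v ≡ edgeOf E v u)
  × (∀ (u v : Fin n) → edgeOf E u v ≡ true → (G u v ≡ true) × u ∈ V × v ∈ V)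
  × Nonempty V
  × (∀ (u v : Fin n) → u ∈ V → v ∈ V → Walk (edgeOf E) u v)

-- F(G) = m : G has exactly m connected subgraphs.
CoreIndex : ∀ {n} → Graph n → ℕ → Set
CoreIndex G m = HasSize (IsConnectedSubgraph G) m

_≅_ : ∀ {n} → Graph n → Graph n → Set
_≅_ {n} G H = Σ (Fin n ↔ Fin n) λ σ →
  ∀ (i j : Fin n) → G i j ≡ H (Inverse.to σ i) (Inverse.to σ j)

-- (k-1)K₁ ∪ K_{1,n-k} on Fin n: vertices 0..k-2 isolated, vertex k-1 the
-- centre, vertices k..n-1 the leaves (for 1 ≤ k ≤ n).
starForest : (n k : ℕ) → Graph n
starForest n k i j =
  ((suc (toℕ i) ≡ᵇ k) ∧ (k ≤ᵇ toℕ j)) ∨ ((suc (toℕ j) ≡ᵇ k) ∧ (k ≤ᵇ toℕ i))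

module Submission where

-- After generalities on walks, counting and bit vectors, the file proves:
--  * forest-bound: in an acyclic graph, a set P of pairwise unconnected
--    vertices has |P| + e ≤ n; one vertex per component gives k + e ≤ n.
--  * Coding: a connected subgraph with an edge is determined by its edge set,
--    one without edges is a single vertex; coding vertex 0 by the empty edge
--    set injects the connected subgraphs into Fin (2^e + (n-1)).  Hence
--    F(G) ≤ 2^e + n - 1 ≤ 2^(n-k) + n - 1.
--  * Extremal: at equality e = n - k and the coding is onto, so any two edges
--    span a connected subgraph, i.e. meet; with no triangles all edges then
--    share a centre (Centre), and counting leaves and isolated vertices
--    yields an explicit isomorphism onto the star forest (StarShape).
--  * StarForestSubgraphs: conversely the star forest has 2^(n-k) + n - 1
--    distinct connected subgraphs (stars at the centre with any leaf set, and
--    the single vertices other than the centre).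

open import Defs
open import Data.Nat using (ℕ; zero; suc; _+_; _∸_; _^_; _≤_; _<_; z≤n; s≤s; _≡ᵇ_; _≤ᵇ_)
import Data.Nat.Properties as ℕP
open import Data.Bool using (Bool; true; false; _∧_; _∨_; not)
import Data.Bool.Properties as BoolP
open import Data.Fin as Fin using (Fin; toℕ; zero; suc; inject₁; fromℕ; fromℕ<; punchOut)
import Data.Fin.Properties as FinP
open import Data.Fin.Subset using (Subset; _∈_; Nonempty)
import Data.Fin.Subset.Properties as SubsetP
open import Data.Vec as Vec using (Vec; lookup; tabulate; []; _∷_)
import Data.Vec.Properties as VecP
open import Data.List as List using (List; []; _∷_; length)
open import Data.List.Membership.Propositional using () renaming (_∈_ to _∈ₗ_)
open import Data.List.Relation.Unary.Any as Any using (here; there)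
import Data.List.Relation.Unary.Any.Properties as AnyP
open import Data.List.Relation.Unary.All as All using (All; _∷_)
open import Data.List.Relation.Unary.Unique.Propositional using (Unique)
open import Data.List.Relation.Unary.AllPairs using (_∷_)
import Data.List.Membership.Propositional.Properties as ∈ₗP
import Data.List.Relation.Unary.Unique.Propositional.Properties as UniqueP
open import Data.Product using (Σ; ∃; _×_; _,_; proj₁; proj₂)
open import Data.Sum using (_⊎_; inj₁; inj₂; [_,_]′)
import Data.Sum.Properties
import Data.Product.Properties
open import Data.Empty using (⊥; ⊥-elim)
open import Data.Unit using (⊤; tt)
open import Relation.Binary.PropositionalEquality
open import Relation.Binary using (tri<; tri≈; tri>)
open import Relation.Nullary using (¬_; Dec; yes; no; does)
open import Relation.Nullary.Decidable using (dec-true; dec-false; decidable-stable; _×-dec_; _⊎-dec_; ¬?)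
open import Function.Bundles using (_⇔_; Inverse; mk⇔; mk↔ₛ′; module Equivalence)
open import Function.Definitions using (Injective)
open import Function using (_∘′_)

_==_ : ∀ {n} → Fin n → Fin n → Bool
x == y = does (x Fin.≟ y)

==⇒≡ : ∀ {n} {x y : Fin n} → x == y ≡ true → x ≡ y
==⇒≡ {x = x} {y} e with x Fin.≟ y
... | yes x≡y = x≡y

==-refl : ∀ {n} (x : Fin n) → x == x ≡ true
==-refl x = dec-true (x Fin.≟ x) refl

≢⇒==-false : ∀ {n} {x y : Fin n} → x ≢ y → x == y ≡ false
≢⇒==-false {x = x} {y} = dec-false (x Fin.≟ y)

true≢false : true ≢ false
true≢false ()

¬true⇒false : ∀ {b : Bool} → ¬ (b ≡ true) → b ≡ false
¬true⇒false {false} _ = refl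
¬true⇒false {true} b≢true = ⊥-elim (b≢true refl)

∨-elim : ∀ {a b : Bool} → a ∨ b ≡ true → a ≡ true ⊎ b ≡ true
∨-elim {true} _ = inj₁ refl
∨-elim {false} b = inj₂ b

∨-introˡ : ∀ {a : Bool} (b : Bool) → a ≡ true → a ∨ b ≡ true
∨-introˡ b refl = refl

∨-introʳ : ∀ (a : Bool) {b} → b ≡ true → a ∨ b ≡ true
∨-introʳ true _ = refl
∨-introʳ false b = b

∧-elim : ∀ {a b : Bool} → a ∧ b ≡ true → a ≡ true × b ≡ true
∧-elim {true} {true} _ = refl , refl

not-true : ∀ {b : Bool} → not b ≡ true → b ≡ false
not-true {false} _ = refl

module _ {n : ℕ} where

  _⊆ᴱ_ : Graph n → Graph n → Set
  R ⊆ᴱ S = ∀ i j → R i j ≡ true → S i j ≡ true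

  IsSymmetric : Graph n → Set
  IsSymmetric R = ∀ i j → R i j ≡ R j i

  walk-map : ∀ {R S : Graph n} → R ⊆ᴱ S → ∀ {u v} → Walk R u v → Walk S u v
  walk-map R⊆S here = here
  walk-map R⊆S (step {u} {w} e p) = step (R⊆S u w e) (walk-map R⊆S p)

  _++ʷ_ : ∀ {R : Graph n} {u v w} → Walk R u v → Walk R v w → Walk R u w
  here ++ʷ q = q
  step e p ++ʷ q = step e (p ++ʷ q)

  reverseʷ : ∀ {R : Graph n} → IsSymmetric R → ∀ {u v} → Walk R u v → Walk R v u
  reverseʷ R-sym here = here
  reverseʷ R-sym (step {u} {w} e p) = reverseʷ R-sym p ++ʷ step (trans (R-sym w u) e) here

  cycle-map : ∀ {R S : Graph n} → R ⊆ᴱ S → Cycle R → Cycle S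
  cycle-map R⊆S (l , c , c-inj , adj , closing) =
    l , c , c-inj , (λ i → R⊆S _ _ (adj i)) , R⊆S _ _ closing

  steps : ∀ {R : Graph n} {u v} → Walk R u v → ℕ
  steps here = 0
  steps (step e p) = suc (steps p)

  vertexAt : ∀ {R : Graph n} {u v} (p : Walk R u v) → Fin (suc (steps p)) → Fin n
  vertexAt {u = u} here _ = u
  vertexAt {u = u} (step e p) zero = u
  vertexAt (step e p) (suc i) = vertexAt p i

  vertexAt-last : ∀ {R : Graph n} {u v} (p : Walk R u v) → vertexAt p (fromℕ (steps p)) ≡ v
  vertexAt-last here = refl
  vertexAt-last (step e p) = vertexAt-last p

  vertexAt-adjacent : ∀ {R : Graph n} {u v} (p : Walk R u v) →
    ∀ i → R (vertexAt p (inject₁ i)) (vertexAt p (suc i)) ≡ true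
  vertexAt-adjacent (step e here) zero = e
  vertexAt-adjacent (step e (step e′ p)) zero = e
  vertexAt-adjacent (step e p) (suc i) = vertexAt-adjacent p i

  _∈ʷ_ : ∀ {R : Graph n} {u v} → Fin n → Walk R u v → Set
  x ∈ʷ p = ∃ λ i → vertexAt p i ≡ x

  _∈ʷ?_ : ∀ {R : Graph n} {u v} x (p : Walk R u v) → Dec (x ∈ʷ p)
  x ∈ʷ? p = FinP.any? (λ i → vertexAt p i Fin.≟ x)

  IsPath : ∀ {R : Graph n} {u v} → Walk R u v → Set
  IsPath here = ⊤
  IsPath {u = u} (step e p) = (¬ (u ∈ʷ p)) × IsPath p

  Path : Graph n → Fin n → Fin n → Set
  Path R u v = Σ (Walk R u v) IsPath

  suffixFrom : ∀ {R : Graph n} {x v} (p : Walk R x v) → IsPath p → ∀ {u} → u ∈ʷ p → Path R u v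
  suffixFrom here _ (zero , refl) = here , tt
  suffixFrom (step e p) p-path (zero , refl) = step e p , p-path
  suffixFrom (step e p) p-path (suc i , eq) = suffixFrom p (proj₂ p-path) (i , eq)

  toPath : ∀ {R : Graph n} {u v} → Walk R u v → Path R u v
  toPath here = here , tt
  toPath {R} {u} (step e p) = prepend (toPath p) e
    where
    prepend : ∀ {w v} → Path R w v → R u w ≡ true → Path R u v
    prepend (q , q-path) e′ with u ∈ʷ? q
    ... | yes u∈q = suffixFrom q q-path u∈q
    ... | no u∉q = step e′ q , u∉q , q-path

  vertexAt-injective : ∀ {R : Graph n} {u v} (p : Walk R u v) → IsPath p →
    ∀ i j → vertexAt p i ≡ vertexAt p j → i ≡ j
  vertexAt-injective here _ zero zero _ = refl
  vertexAt-injective (step e p) _ zero zero _ = refl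
  vertexAt-injective (step e p) p-path zero (suc j) eq = ⊥-elim (proj₁ p-path (j , sym eq))
  vertexAt-injective (step e p) p-path (suc i) zero eq = ⊥-elim (proj₁ p-path (i , eq))
  vertexAt-injective (step e p) p-path (suc i) (suc j) eq =
    cong suc (vertexAt-injective p (proj₂ p-path) i j eq)

  -- In an acyclic graph every edge is a bridge: if the edge uv of R is missing
  -- from R′ ⊆ R, then R′ has no walk from u to v (a path u ⋯ v of length ≥ 2
  -- closes up with vu to a cycle of R).
  edge-is-bridge : ∀ {R R′ : Graph n} → IsSymmetric R → R′ ⊆ᴱ R → ¬ Cycle R →
    ∀ {u v} → u ≢ v → R u v ≡ true → R′ u v ≡ false → ¬ Walk R′ u v
  edge-is-bridge {R} {R′} R-sym R′⊆R acyclic {u} {v} u≢v uv∈R uv∉R′ walk with toPath walk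
  ... | here , _ = u≢v refl
  ... | step e here , _ = true≢false (trans (sym e) uv∉R′)
  ... | p@(step e (step e′ q)) , p-path =
    acyclic (steps q , vertexAt p , (λ {i} {j} → vertexAt-injective p p-path i j) ,
             (λ i → R′⊆R _ _ (vertexAt-adjacent p i)) , closing)
    where
    closing : R (vertexAt p (fromℕ (suc (suc (steps q))))) u ≡ true
    closing rewrite vertexAt-last q = trans (R-sym v u) uv∈R

indicator : Bool → ℕ
indicator true = 1
indicator false = 0

count : ∀ {n} → (Fin n → Bool) → ℕ
count {zero} P = 0
count {suc n} P = indicator (P zero) + count (λ x → P (suc x))

rank : ∀ {n} → (Fin n → Bool) → Fin n → ℕ
rank P zero = 0
rank P (suc x) = indicator (P zero) + rank (λ y → P (suc y)) x

count-≤ : ∀ {n} (P : Fin n → Bool) → count P ≤ n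
count-≤ {zero} P = z≤n
count-≤ {suc n} P with P zero
... | true = s≤s (count-≤ (λ x → P (suc x)))
... | false = ℕP.m≤n⇒m≤1+n (count-≤ (λ x → P (suc x)))

count-cong : ∀ {n} {P Q : Fin n → Bool} → (∀ x → P x ≡ Q x) → count P ≡ count Q
count-cong {zero} P≗Q = refl
count-cong {suc n} P≗Q = cong₂ _+_ (cong indicator (P≗Q zero)) (count-cong (λ x → P≗Q (suc x)))

count-insert : ∀ {n} (P : Fin n → Bool) u → P u ≡ false →
  count (λ x → P x ∨ x == u) ≡ suc (count P)
count-insert {suc n} P zero Pu≡false rewrite Pu≡false =
  cong suc (count-cong (λ x → BoolP.∨-identityʳ (P (suc x))))
count-insert {suc n} P (suc u) Pu≡false = begin
  indicator (P zero ∨ false) + count (λ x → P (suc x) ∨ suc x == suc u)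
    ≡⟨ cong₂ _+_ (cong indicator (BoolP.∨-identityʳ (P zero)))
                 (count-cong (λ x → cong (P (suc x) ∨_) (shift x))) ⟩
  indicator (P zero) + count (λ x → P (suc x) ∨ x == u)
    ≡⟨ cong (indicator (P zero) +_) (count-insert (λ x → P (suc x)) u Pu≡false) ⟩
  indicator (P zero) + suc (count (λ x → P (suc x)))
    ≡⟨ ℕP.+-suc (indicator (P zero)) (count (λ x → P (suc x))) ⟩
  suc (count P) ∎
  where
  open ≡-Reasoning
  shift : ∀ x → suc x == suc u ≡ x == u
  shift x with x Fin.≟ u
  ... | yes _ = refl
  ... | no _ = refl

rank-<-count : ∀ {n} (P : Fin n → Bool) x → P x ≡ true → rank P x < count P
rank-<-count P zero Px rewrite Px = s≤s z≤n
rank-<-count P (suc x) Px = ℕP.+-monoʳ-< (indicator (P zero)) (rank-<-count (λ y → P (suc y)) x Px)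

rank-strictMono : ∀ {n} (P : Fin n → Bool) x y → P x ≡ true → toℕ x < toℕ y → rank P x < rank P y
rank-strictMono P zero (suc y) Px _ rewrite Px = s≤s z≤n
rank-strictMono P (suc x) (suc y) Px (s≤s x<y) =
  ℕP.+-monoʳ-< (indicator (P zero)) (rank-strictMono (λ z → P (suc z)) x y Px x<y)

rank-injective : ∀ {n} (P : Fin n → Bool) x y → P x ≡ true → P y ≡ true → rank P x ≡ rank P y → x ≡ y
rank-injective P x y Px Py eq with ℕP.<-cmp (toℕ x) (toℕ y)
... | tri< x<y _ _ = ⊥-elim (ℕP.<-irrefl eq (rank-strictMono P x y Px x<y))
... | tri≈ _ x≡y _ = FinP.toℕ-injective x≡y
... | tri> _ _ y<x = ⊥-elim (ℕP.<-irrefl (sym eq) (rank-strictMono P y x Py y<x))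

count-≤-injection : ∀ {n N} (P : Fin n → Bool) (g : ∀ x → P x ≡ true → Fin N) →
  (∀ x y Px Py → g x Px ≡ g y Py → x ≡ y) → count P ≤ N
count-≤-injection {zero} P g g-inj = z≤n
count-≤-injection {suc n} {N} P g g-inj with P zero in P0
... | false = count-≤-injection (λ x → P (suc x)) (λ x Px → g (suc x) Px)
                (λ x y Px Py eq → FinP.suc-injective (g-inj (suc x) (suc y) Px Py eq))
... | true = drop-zero N g g-inj
  where
  drop-zero : ∀ N (g : ∀ x → P x ≡ true → Fin N) →
    (∀ x y Px Py → g x Px ≡ g y Py → x ≡ y) → suc (count (λ x → P (suc x))) ≤ N
  drop-zero zero g g-inj with g zero P0
  ... | ()
  drop-zero (suc N) g g-inj = s≤s (count-≤-injection (λ x → P (suc x))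
      (λ x Px → punchOut (apart x Px))
      (λ x y Px Py eq → FinP.suc-injective (g-inj (suc x) (suc y) Px Py
        (FinP.punchOut-injective (apart x Px) (apart y Py) eq))))
    where
    apart : ∀ x Px → g zero P0 ≢ g (suc x) Px
    apart x Px eq with g-inj zero (suc x) P0 Px eq
    ... | ()

injection-≤-count : ∀ {n N} (P : Fin n → Bool) (h : Fin N → Fin n) →
  Injective _≡_ _≡_ h → (∀ i → P (h i) ≡ true) → N ≤ count P
injection-≤-count {N = N} P h h-inj P∘h = FinP.injective⇒≤ {f = rank∘h} rank∘h-injective
  where
  rank∘h : Fin N → Fin (count P)
  rank∘h i = fromℕ< (rank-<-count P (h i) (P∘h i))
  rank∘h-injective : Injective _≡_ _≡_ rank∘h
  rank∘h-injective {i} {j} eq = h-inj (rank-injective P (h i) (h j) (P∘h i) (P∘h j)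
    (trans (sym (FinP.toℕ-fromℕ< _)) (trans (cong toℕ eq) (FinP.toℕ-fromℕ< _))))

injective⇒surjective : ∀ {m N} (f : Fin m → Fin N) → Injective _≡_ _≡_ f → N ≤ m →
  ∀ y → ∃ λ x → f x ≡ y
injective⇒surjective {m} {suc N} f f-inj N≤m y with FinP.any? (λ x → f x Fin.≟ y)
... | yes hit = hit
... | no miss = ⊥-elim (ℕP.<-irrefl refl (ℕP.≤-trans N≤m (FinP.injective⇒≤ {f = g} g-inj)))
  where
  avoids : ∀ x → y ≢ f x
  avoids x eq = miss (x , sym eq)
  g : Fin m → Fin N
  g x = punchOut (avoids x)
  g-inj : Injective _≡_ _≡_ g
  g-inj eq = f-inj (FinP.punchOut-injective (avoids _) (avoids _) eq)

size-≤ : ∀ {A : Set} {P : A → Set} {m N} → HasSize P m →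
  (g : (a : A) → P a → Fin N) → (∀ a b Pa Pb → g a Pa ≡ g b Pb → a ≡ b) → m ≤ N
size-≤ (f , f-inj , Pf , _) g g-inj =
  FinP.injective⇒≤ {f = λ i → g (f i) (Pf i)} (λ eq → f-inj (g-inj _ _ _ _ eq))

size-≥ : ∀ {A : Set} {P : A → Set} {m N} → HasSize P m →
  (h : Fin N → A) → Injective _≡_ _≡_ h → (∀ i → P (h i)) → N ≤ m
size-≥ {m = m} {N} (f , _ , _ , f-onto) h h-inj P∘h = FinP.injective⇒≤ {f = index} index-inj
  where
  index : Fin N → Fin m
  index i = proj₁ (f-onto (h i) (P∘h i))
  index-inj : Injective _≡_ _≡_ index
  index-inj {i} {j} eq = h-inj (trans (sym (proj₂ (f-onto (h i) (P∘h i))))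
                           (trans (cong f eq) (proj₂ (f-onto (h j) (P∘h j)))))

bit : Bool → Fin 2
bit false = zero
bit true = suc zero

unbit : Fin 2 → Bool
unbit zero = false
unbit (suc zero) = true

unbit∘bit : ∀ b → unbit (bit b) ≡ b
unbit∘bit false = refl
unbit∘bit true = refl

bit∘unbit : ∀ i → bit (unbit i) ≡ i
bit∘unbit zero = refl
bit∘unbit (suc zero) = refl

encode : ∀ {e} → Vec Bool e → Fin (2 ^ e)
encode [] = zero
encode (b ∷ bs) = Fin.combine (bit b) (encode bs)

encode-injective : ∀ {e} (xs ys : Vec Bool e) → encode xs ≡ encode ys → xs ≡ ys
encode-injective [] [] _ = refl
encode-injective (x ∷ xs) (y ∷ ys) eq
  with FinP.combine-injective (bit x) (encode xs) (bit y) (encode ys) eq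
... | x≡y , xs≡ys = cong₂ _∷_ (trans (sym (unbit∘bit x)) (trans (cong unbit x≡y) (unbit∘bit y)))
                               (encode-injective xs ys xs≡ys)

decode : ∀ {e} → Fin (2 ^ e) → Vec Bool e
decode {zero} _ = []
decode {suc e} i = unbit (proj₁ (Fin.remQuot {2} (2 ^ e) i)) ∷ decode {e} (proj₂ (Fin.remQuot {2} (2 ^ e) i))

encode∘decode : ∀ {e} (i : Fin (2 ^ e)) → encode (decode {e} i) ≡ i
encode∘decode {zero} zero = refl
encode∘decode {suc e} i = trans
  (cong₂ Fin.combine (bit∘unbit (proj₁ (Fin.remQuot {2} (2 ^ e) i)))
                     (encode∘decode {e} (proj₂ (Fin.remQuot {2} (2 ^ e) i))))
  (FinP.combine-remQuot {2} (2 ^ e) i)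

decode-injective : ∀ {e} (i j : Fin (2 ^ e)) → decode {e} i ≡ decode j → i ≡ j
decode-injective {e} i j eq = trans (sym (encode∘decode {e} i)) (trans (cong encode eq) (encode∘decode {e} j))

join-injective : ∀ a b {x y} → Fin.join a b x ≡ Fin.join a b y → x ≡ y
join-injective a b {x} {y} eq =
  trans (sym (FinP.splitAt-join a b x)) (trans (cong (Fin.splitAt a) eq) (FinP.splitAt-join a b y))

splitAt-injective : ∀ a b {i j} → Fin.splitAt a {b} i ≡ Fin.splitAt a j → i ≡ j
splitAt-injective a b {i} {j} eq =
  trans (sym (FinP.join-splitAt a b i)) (trans (cong (Fin.join a b) eq) (FinP.join-splitAt a b j))

indicatorVec : ∀ {A : Set} → (A → Bool) → (L : List A) → Vec Bool (length L)
indicatorVec f [] = []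
indicatorVec f (x ∷ L) = f x ∷ indicatorVec f L

zeros : ∀ e → Vec Bool e
zeros e = Vec.replicate e false

indicatorVec-≡ : ∀ {A : Set} {f g : A → Bool} (L : List A) {x} → x ∈ₗ L →
  indicatorVec f L ≡ indicatorVec g L → f x ≡ g x
indicatorVec-≡ (y ∷ L) (here refl) eq = VecP.∷-injectiveˡ eq
indicatorVec-≡ (y ∷ L) (there x∈L) eq = indicatorVec-≡ L x∈L (VecP.∷-injectiveʳ eq)

indicatorVec-zeros : ∀ {A : Set} {f : A → Bool} (L : List A) →
  (∀ x → x ∈ₗ L → f x ≡ false) → indicatorVec f L ≡ zeros (length L)
indicatorVec-zeros [] _ = refl
indicatorVec-zeros (x ∷ L) f≡false =
  cong₂ _∷_ (f≡false x (here refl)) (indicatorVec-zeros L (λ y y∈L → f≡false y (there y∈L)))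

indicatorVec-zeros⁻ : ∀ {A : Set} {f : A → Bool} (L : List A) → indicatorVec f L ≡ zeros (length L) →
  ∀ {x} → x ∈ₗ L → f x ≡ false
indicatorVec-zeros⁻ L eq x∈L =
  indicatorVec-≡ L x∈L (trans eq (sym (indicatorVec-zeros L (λ _ _ → refl))))

vec-ext : ∀ {A : Set} {n} (xs ys : Vec A n) → (∀ i → lookup xs i ≡ lookup ys i) → xs ≡ ys
vec-ext xs ys xs≗ys =
  trans (sym (VecP.tabulate∘lookup xs)) (trans (VecP.tabulate-cong xs≗ys) (VecP.tabulate∘lookup ys))

∈⇒lookup : ∀ {n} {p : Subset n} {x} → x ∈ p → lookup p x ≡ true
∈⇒lookup = VecP.[]=⇒lookup

lookup⇒∈ : ∀ {n} {p : Subset n} {x} → lookup p x ≡ true → x ∈ p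
lookup⇒∈ {p = p} {x} = VecP.lookup⇒[]= x p

∈-tabulate : ∀ {n} (f : Fin n → Bool) {x} → x ∈ tabulate f → f x ≡ true
∈-tabulate f {x} x∈ = trans (sym (VecP.lookup∘tabulate f x)) (∈⇒lookup x∈)

tabulate-∈ : ∀ {n} (f : Fin n → Bool) {x} → f x ≡ true → x ∈ tabulate f
tabulate-∈ f {x} fx = lookup⇒∈ (trans (VecP.lookup∘tabulate f x) fx)

edgeOf-tabulate : ∀ {n} (f : Fin n → Fin n → Bool) u v →
  edgeOf (tabulate (λ u → tabulate (f u))) u v ≡ f u v
edgeOf-tabulate f u v = trans (cong (λ r → lookup r v) (VecP.lookup∘tabulate (λ u → tabulate (f u)) u))
                               (VecP.lookup∘tabulate (f u) v)

Edge : ℕ → Set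
Edge n = Fin n × Fin n

_≟ₑ_ : ∀ {n} (p q : Edge n) → Dec (p ≡ q)
_≟ₑ_ = Data.Product.Properties.≡-dec Fin._≟_ Fin._≟_

graphOf : ∀ {n} → List (Edge n) → Graph n
graphOf [] i j = false
graphOf ((a , b) ∷ L) i j = ((a == i ∧ b == j) ∨ (a == j ∧ b == i)) ∨ graphOf L i j

graphOf⁻ : ∀ {n} (L : List (Edge n)) i j → graphOf L i j ≡ true → (i , j) ∈ₗ L ⊎ (j , i) ∈ₗ L
graphOf⁻ [] i j ()
graphOf⁻ ((a , b) ∷ L) i j ij∈ with ∨-elim {(a == i ∧ b == j) ∨ (a == j ∧ b == i)} ij∈
... | inj₂ ij∈L with graphOf⁻ L i j ij∈L
...   | inj₁ m = inj₁ (there m)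
...   | inj₂ m = inj₂ (there m)
graphOf⁻ ((a , b) ∷ L) i j _ | inj₁ ab≈ij with ∨-elim {a == i ∧ b == j} ab≈ij
... | inj₁ same with ∧-elim {a == i} same
...   | a≡i , b≡j with ==⇒≡ {x = a} {i} a≡i | ==⇒≡ {x = b} {j} b≡j
...     | refl | refl = inj₁ (here refl)
graphOf⁻ ((a , b) ∷ L) i j _ | inj₁ _ | inj₂ flipped with ∧-elim {a == j} flipped
...   | a≡j , b≡i with ==⇒≡ {x = a} {j} a≡j | ==⇒≡ {x = b} {i} b≡i
...     | refl | refl = inj₂ (here refl)

graphOf⁺ : ∀ {n} (L : List (Edge n)) i j → (i , j) ∈ₗ L → graphOf L i j ≡ true
graphOf⁺ ((a , b) ∷ L) i j (here refl) rewrite ==-refl i | ==-refl j = refl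
graphOf⁺ ((a , b) ∷ L) i j (there ij∈L) =
  ∨-introʳ ((a == i ∧ b == j) ∨ (a == j ∧ b == i)) (graphOf⁺ L i j ij∈L)

graphOf-symmetric : ∀ {n} (L : List (Edge n)) → IsSymmetric (graphOf L)
graphOf-symmetric [] i j = refl
graphOf-symmetric ((a , b) ∷ L) i j =
  cong₂ _∨_ (BoolP.∨-comm (a == i ∧ b == j) (a == j ∧ b == i)) (graphOf-symmetric L i j)

graphOf-∷ : ∀ {n} (ab : Edge n) (L : List (Edge n)) → graphOf L ⊆ᴱ graphOf (ab ∷ L)
graphOf-∷ (a , b) L i j ij∈L = ∨-introʳ ((a == i ∧ b == j) ∨ (a == j ∧ b == i)) ij∈L

-- Edges are listed as (i , j) with i < j, so that no edge occurs twice.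
Ordered : ∀ {n} → Edge n → Set
Ordered (i , j) = i Fin.< j

Separated : ∀ {n} → (Fin n → Bool) → Graph n → Set
Separated {n} P R = ∀ (a b : Fin n) → P a ≡ true → P b ≡ true → Walk R a b → a ≡ b

-- Removing an edge uv, one of u, v is joined to no
-- P-vertex (else uv closes a cycle) and can be added to P.  Reachability of P
-- is not decided; as the bound is decidable it suffices to refute its
-- negation, which would force both u and v to reach P.
forest-bound : ∀ {n} (L : List (Edge n)) → Unique L → All Ordered L → ¬ Cycle (graphOf L) →
  (P : Fin n → Bool) → Separated P (graphOf L) → count P + length L ≤ n
forest-bound [] _ _ _ P _ rewrite ℕP.+-identityʳ (count P) = count-≤ P
forest-bound {n} ((u , v) ∷ L) (uv∉L ∷ L-unique) (u<v ∷ L-ordered) acyclic P P-separated =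
  decidable-stable (count P + suc (length L) ℕP.≤? n)
    (λ ¬bound → ¬bound (add-root u λ u-reaches →
                        ¬bound (add-root v λ v-reaches → not-both u-reaches v-reaches)))
  where
  R R′ : Graph n
  R = graphOf ((u , v) ∷ L)
  R′ = graphOf L
  R′⊆R : R′ ⊆ᴱ R
  R′⊆R = graphOf-∷ (u , v) L
  u≢v : u ≢ v
  u≢v u≡v = ℕP.<-irrefl (cong toℕ u≡v) u<v
  uv∉R′ : R′ u v ≡ false
  uv∉R′ = ¬true⇒false λ uv∈R′ → case (graphOf⁻ L u v uv∈R′)
    where
    case : (u , v) ∈ₗ L ⊎ (v , u) ∈ₗ L → ⊥
    case (inj₁ uv∈L) = All.lookup uv∉L uv∈L refl
    case (inj₂ vu∈L) = ℕP.<-asym u<v (All.lookup L-ordered vu∈L)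
  no-walk : ¬ Walk R′ u v
  no-walk = edge-is-bridge (graphOf-symmetric ((u , v) ∷ L)) R′⊆R acyclic u≢v
              (graphOf⁺ ((u , v) ∷ L) u v (here refl)) uv∉R′

  Reaches : Fin n → Set
  Reaches x = ∃ λ r → P r ≡ true × Walk R′ x r

  add-root : ∀ w → ¬ Reaches w → count P + suc (length L) ≤ n
  add-root w ¬reaches = subst (_≤ n) (sym (ℕP.+-suc (count P) (length L)))
    (subst (λ c → c + length L ≤ n) (count-insert P w Pw≡false)
      (forest-bound L L-unique L-ordered (acyclic ∘′ cycle-map R′⊆R) P′ P′-separated))
    where
    Pw≡false : P w ≡ false
    Pw≡false = ¬true⇒false λ Pw → ¬reaches (w , Pw , here)
    P′ : Fin n → Bool
    P′ x = P x ∨ x == w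
    P′-cases : ∀ x → P′ x ≡ true → P x ≡ true ⊎ x ≡ w
    P′-cases x P′x with ∨-elim {P x} P′x
    ... | inj₁ Px = inj₁ Px
    ... | inj₂ x≡w = inj₂ (==⇒≡ x≡w)
    P′-separated : Separated P′ R′
    P′-separated a b P′a P′b walk with P′-cases a P′a | P′-cases b P′b
    ... | inj₁ Pa | inj₁ Pb = P-separated a b Pa Pb (walk-map R′⊆R walk)
    ... | inj₁ Pa | inj₂ refl = ⊥-elim (¬reaches (a , Pa , reverseʷ (graphOf-symmetric L) walk))
    ... | inj₂ refl | inj₁ Pb = ⊥-elim (¬reaches (b , Pb , walk))
    ... | inj₂ refl | inj₂ refl = refl

  -- If both u and v reach P-vertices, these are joined through uv, hence
  -- equal, and then u, v are joined in R′.
  not-both : Reaches u → Reaches v → ⊥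
  not-both (ru , Pru , u⋯ru) (rv , Prv , v⋯rv)
    with P-separated ru rv Pru Prv
           (walk-map R′⊆R (reverseʷ (graphOf-symmetric L) u⋯ru)
              ++ʷ step (graphOf⁺ ((u , v) ∷ L) u v (here refl)) (walk-map R′⊆R v⋯rv))
  ... | refl = no-walk (u⋯ru ++ʷ reverseʷ (graphOf-symmetric L) v⋯rv)

module SimpleGraph {n : ℕ} (G : Graph n) (G-simple : IsSimple G) where

  G-symmetric : IsSymmetric G
  G-symmetric = proj₁ G-simple

  G-loopless : ∀ i → G i i ≡ false
  G-loopless = proj₂ G-simple

  isOrderedEdge? : (p : Edge n) → Dec (Ordered p × G (proj₁ p) (proj₂ p) ≡ true)
  isOrderedEdge? (i , j) = (i Fin.<? j) ×-dec (G i j BoolP.≟ true)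

  edges : List (Edge n)
  edges = List.filter isOrderedEdge? (List.cartesianProduct (List.allFin n) (List.allFin n))

  #edges : ℕ
  #edges = length edges

  edges-unique : Unique edges
  edges-unique = UniqueP.filter⁺ isOrderedEdge?
    (UniqueP.cartesianProduct⁺ (UniqueP.allFin⁺ n) (UniqueP.allFin⁺ n))

  edges⁻ : ∀ {i j} → (i , j) ∈ₗ edges → i Fin.< j × G i j ≡ true
  edges⁻ ij∈ = proj₂ (∈ₗP.∈-filter⁻ isOrderedEdge?
    {xs = List.cartesianProduct (List.allFin n) (List.allFin n)} ij∈)

  edges⁺ : ∀ {i j} → i Fin.< j → G i j ≡ true → (i , j) ∈ₗ edges
  edges⁺ {i} {j} i<j ij∈G = ∈ₗP.∈-filter⁺ isOrderedEdge?
    (∈ₗP.∈-cartesianProduct⁺ (∈ₗP.∈-allFin i) (∈ₗP.∈-allFin j)) (i<j , ij∈G)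

  edges-ordered : All Ordered edges
  edges-ordered = All.tabulate λ {p} → ordered p
    where
    ordered : ∀ p → p ∈ₗ edges → Ordered p
    ordered (i , j) ij∈ = proj₁ (edges⁻ ij∈)

  adjacent⇒≢ : ∀ {i j} → G i j ≡ true → i ≢ j
  adjacent⇒≢ ij∈G refl = true≢false (trans (sym ij∈G) (G-loopless _))

  edge-listed : ∀ {i j} → G i j ≡ true → (i , j) ∈ₗ edges ⊎ (j , i) ∈ₗ edges
  edge-listed {i} {j} ij∈G with ℕP.<-cmp (toℕ i) (toℕ j)
  ... | tri< i<j _ _ = inj₁ (edges⁺ i<j ij∈G)
  ... | tri≈ _ i≡j _ = ⊥-elim (adjacent⇒≢ ij∈G (FinP.toℕ-injective i≡j))
  ... | tri> _ _ j<i = inj₂ (edges⁺ j<i (trans (G-symmetric j i) ij∈G))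

  listed⊆G : graphOf edges ⊆ᴱ G
  listed⊆G i j ij∈ with graphOf⁻ edges i j ij∈
  ... | inj₁ ij∈E = proj₂ (edges⁻ ij∈E)
  ... | inj₂ ji∈E = trans (G-symmetric i j) (proj₂ (edges⁻ ji∈E))

  -- The degree of a vertex is at most the number of edges: the listed edges
  -- through c are distinct for distinct neighbours.
  degree-≤ : ∀ c → count (G c) ≤ #edges
  degree-≤ c = count-≤-injection (G c) position position-injective
    where
    Through : Fin n → Edge n → Set
    Through l p = p ≡ (c , l) ⊎ p ≡ (l , c)
    entry : ∀ l → G c l ≡ true → Σ (Edge n) λ p → p ∈ₗ edges × Through l p
    entry l cl with edge-listed cl
    ... | inj₁ cl∈ = _ , cl∈ , inj₁ refl
    ... | inj₂ lc∈ = _ , lc∈ , inj₂ refl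
    position : ∀ l → G c l ≡ true → Fin #edges
    position l cl = Any.index (proj₁ (proj₂ (entry l cl)))
    at-position : ∀ l cl → List.lookup edges (position l cl) ≡ proj₁ (entry l cl)
    at-position l cl = sym (AnyP.lookup-index (proj₁ (proj₂ (entry l cl))))
    same-end : ∀ {x y p} → Through x p → Through y p → x ≡ y
    same-end (inj₁ refl) (inj₁ refl) = refl
    same-end (inj₁ refl) (inj₂ refl) = refl
    same-end (inj₂ refl) (inj₁ refl) = refl
    same-end (inj₂ refl) (inj₂ refl) = refl
    position-injective : ∀ x y cx cy → position x cx ≡ position y cy → x ≡ y
    position-injective x y cx cy eq = same-end (proj₂ (proj₂ (entry x cx)))
      (subst (Through y) (trans (sym (at-position y cy)) (trans (cong (List.lookup edges) (sym eq)) (at-position x cx)))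
             (proj₂ (proj₂ (entry y cy))))

  component-closed : ∀ {C} → IsComponent G C → ∀ {u v} → u ∈ C → Walk G u v → v ∈ C
  component-closed C-comp u∈C here = u∈C
  component-closed C-comp u∈C (step e walk) =
    component-closed C-comp (proj₁ (proj₂ C-comp) _ _ u∈C e) walk

  component-unique : ∀ {C D} → IsComponent G C → IsComponent G D → ∀ {x} → x ∈ C → x ∈ D → C ≡ D
  component-unique {C} {D} C-comp D-comp {x} x∈C x∈D = SubsetP.⊆-antisym
    (λ {y} y∈C → component-closed D-comp x∈D (proj₂ (proj₂ C-comp) x y x∈C y∈C))
    (λ {y} y∈D → component-closed C-comp x∈C (proj₂ (proj₂ D-comp) x y x∈D y∈D))

  forest-bound-G : Acyclic G → (P : Fin n → Bool) → Separated P (graphOf edges) →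
    count P + #edges ≤ n
  forest-bound-G acyclic = forest-bound edges edges-unique edges-ordered (acyclic ∘′ cycle-map listed⊆G)

  -- Edge bound: an acyclic graph with k components has k + e ≤ n (one root
  -- per component gives a separated set of size k).
  edge-bound : ∀ {k} → Acyclic G → NumComponents G k → k + #edges ≤ n
  edge-bound {k} acyclic (C , C-inj , C-comp , _) =
    ℕP.≤-trans (ℕP.+-monoˡ-≤ #edges (injection-≤-count isRoot root root-injective isRoot-root))
               (forest-bound-G acyclic isRoot roots-separated)
    where
    root : Fin k → Fin n
    root i = proj₁ (proj₁ (C-comp i))
    root∈C : ∀ i → root i ∈ C i
    root∈C i = proj₂ (proj₁ (C-comp i))
    same-component : ∀ i j → root i ∈ C j → i ≡ j
    same-component i j ri∈Cj = C-inj (component-unique (C-comp i) (C-comp j) (root∈C i) ri∈Cj)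
    root-injective : Injective _≡_ _≡_ root
    root-injective {i} {j} ri≡rj = same-component i j (subst (_∈ C j) (sym ri≡rj) (root∈C j))
    isRoot : Fin n → Bool
    isRoot v = does (FinP.any? (λ i → root i Fin.≟ v))
    isRoot-root : ∀ i → isRoot (root i) ≡ true
    isRoot-root i = dec-true (FinP.any? (λ j → root j Fin.≟ root i)) (i , refl)
    isRoot⇒root : ∀ v → isRoot v ≡ true → ∃ λ i → root i ≡ v
    isRoot⇒root v isRoot-v with FinP.any? (λ i → root i Fin.≟ v)
    ... | yes found = found
    roots-separated : Separated isRoot (graphOf edges)
    roots-separated a b root-a root-b walk with isRoot⇒root a root-a | isRoot⇒root b root-b
    ... | i , refl | j , refl =
      cong root (same-component i j (component-closed (C-comp j) (root∈C j)
        (reverseʷ G-symmetric (walk-map listed⊆G walk))))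

  #edges≤n∸k : ∀ {k} → Acyclic G → NumComponents G k → #edges ≤ n ∸ k
  #edges≤n∸k {k} acyclic components =
    ℕP.m+n≤o⇒m≤o∸n #edges (subst (_≤ n) (ℕP.+-comm k #edges) (edge-bound acyclic components))

module Coding {n′ : ℕ} (G : Graph (suc n′)) (G-simple : IsSimple G) where
  open SimpleGraph G G-simple public

  n : ℕ
  n = suc n′

  edgeBits : Vec (Subset n) n → Vec Bool #edges
  edgeBits E = indicatorVec (λ p → edgeOf E (proj₁ p) (proj₂ p)) edges

  Edgeless : Vec (Subset n) n → Set
  Edgeless E = ∀ u v → edgeOf E u v ≡ false

  edgeless-unique : ∀ {E₁ E₂} → Edgeless E₁ → Edgeless E₂ → E₁ ≡ E₂
  edgeless-unique {E₁} {E₂} E₁-edgeless E₂-edgeless =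
    vec-ext E₁ E₂ λ u → vec-ext _ _ λ v → trans (E₁-edgeless u v) (sym (E₂-edgeless u v))

  module Connected (V : Subset n) (E : Vec (Subset n) n) (conn : IsConnectedSubgraph G (V , E)) where
    E-symmetric : IsSymmetric (edgeOf E)
    E-symmetric = proj₁ conn

    E-sub : ∀ u v → edgeOf E u v ≡ true → (G u v ≡ true) × u ∈ V × v ∈ V
    E-sub = proj₁ (proj₂ conn)

    V-nonempty : Nonempty V
    V-nonempty = proj₁ (proj₂ (proj₂ conn))

    V-connected : ∀ u v → u ∈ V → v ∈ V → Walk (edgeOf E) u v
    V-connected = proj₂ (proj₂ (proj₂ conn))

    E-listed : ∀ {u v} → edgeOf E u v ≡ true → (u , v) ∈ₗ edges ⊎ (v , u) ∈ₗ edges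
    E-listed uv∈E = edge-listed (proj₁ (E-sub _ _ uv∈E))

    zeros⇒edgeless : edgeBits E ≡ zeros #edges → Edgeless E
    zeros⇒edgeless bits≡0 u v = ¬true⇒false λ uv∈E → true≢false (trans (sym uv∈E) (case (E-listed uv∈E)))
      where
      case : (u , v) ∈ₗ edges ⊎ (v , u) ∈ₗ edges → edgeOf E u v ≡ false
      case (inj₁ uv∈) = indicatorVec-zeros⁻ edges bits≡0 uv∈
      case (inj₂ vu∈) = trans (E-symmetric u v) (indicatorVec-zeros⁻ edges bits≡0 vu∈)

    edgeless⇒zeros : Edgeless E → edgeBits E ≡ zeros #edges
    edgeless⇒zeros E-edgeless = indicatorVec-zeros edges (λ p _ → E-edgeless (proj₁ p) (proj₂ p))

    edgeless⇒single : Edgeless E → ∀ {u v} → u ∈ V → v ∈ V → u ≡ v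
    edgeless⇒single E-edgeless {u} {v} u∈V v∈V with V-connected u v u∈V v∈V
    ... | here = refl
    ... | step e _ = ⊥-elim (true≢false (trans (sym e) (E-edgeless _ _)))

  edgeBits-injective : ∀ V₁ V₂ E₁ E₂ → IsConnectedSubgraph G (V₁ , E₁) → IsConnectedSubgraph G (V₂ , E₂) →
    edgeBits E₁ ≡ edgeBits E₂ → E₁ ≡ E₂
  edgeBits-injective V₁ V₂ E₁ E₂ conn₁ conn₂ bits≡ =
    vec-ext _ _ λ u → vec-ext _ _ λ v →
      bool-ext (included V₁ V₂ E₁ E₂ conn₁ conn₂ bits≡) (included V₂ V₁ E₂ E₁ conn₂ conn₁ (sym bits≡))
    where
    bool-ext : ∀ {a b : Bool} → (a ≡ true → b ≡ true) → (b ≡ true → a ≡ true) → a ≡ b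
    bool-ext {false} {false} _ _ = refl
    bool-ext {false} {true} _ b⇒a = b⇒a refl
    bool-ext {true} {false} a⇒b _ = sym (a⇒b refl)
    bool-ext {true} {true} _ _ = refl
    included : ∀ Va Vb Ea Eb → IsConnectedSubgraph G (Va , Ea) → IsConnectedSubgraph G (Vb , Eb) →
      edgeBits Ea ≡ edgeBits Eb → ∀ {u v} → edgeOf Ea u v ≡ true → edgeOf Eb u v ≡ true
    included Va Vb Ea Eb conn-a conn-b bits≡ {u} {v} uv∈Ea with A.E-listed uv∈Ea
      where module A = Connected Va Ea conn-a
    ... | inj₁ uv∈ = trans (sym (indicatorVec-≡ edges uv∈ bits≡)) uv∈Ea
    ... | inj₂ vu∈ = trans (Connected.E-symmetric Vb Eb conn-b u v)
        (trans (sym (indicatorVec-≡ edges vu∈ bits≡))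
               (trans (sym (Connected.E-symmetric Va Ea conn-a u v)) uv∈Ea))

  -- A connected subgraph with an edge has no isolated vertex, so its vertex
  -- set is determined by its edge set.
  vertices-determined : ∀ V₁ V₂ E → IsConnectedSubgraph G (V₁ , E) → IsConnectedSubgraph G (V₂ , E) →
    edgeBits E ≢ zeros #edges → ∀ {u} → u ∈ V₁ → u ∈ V₂
  vertices-determined V₁ V₂ E conn₁ conn₂ bits≢0 {u} u∈V₁ =
    decidable-stable (u SubsetP.∈? V₂) λ u∉V₂ → bits≢0 (C₁.edgeless⇒zeros (edgeless u∉V₂))
    where
    module C₁ = Connected V₁ E conn₁
    module C₂ = Connected V₂ E conn₂
    -- If u ∉ V₂ then u has no E-neighbour, and by connectivity neither has
    -- any other vertex.
    edgeless : ¬ (u ∈ V₂) → Edgeless E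
    edgeless u∉V₂ a b = ¬true⇒false λ ab∈E →
      first-step (C₁.V-connected u a u∈V₁ (proj₁ (proj₂ (C₁.E-sub a b ab∈E)))) ab∈E
      where
      isolated : ∀ w → ¬ (edgeOf E u w ≡ true)
      isolated w uw∈E = u∉V₂ (proj₁ (proj₂ (C₂.E-sub u w uw∈E)))
      first-step : ∀ {a′} → Walk (edgeOf E) u a′ → edgeOf E a′ b ≡ true → ⊥
      first-step here ub∈E = isolated b ub∈E
      first-step (step uw∈E _) _ = isolated _ uw∈E

  edgeBits-determine : ∀ V₁ V₂ E₁ E₂ → IsConnectedSubgraph G (V₁ , E₁) → IsConnectedSubgraph G (V₂ , E₂) →
    edgeBits E₁ ≢ zeros #edges → edgeBits E₁ ≡ edgeBits E₂ → (V₁ , E₁) ≡ (V₂ , E₂)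
  edgeBits-determine V₁ V₂ E₁ E₂ conn₁ conn₂ bits≢0 bits≡ =
    same-edges (edgeBits-injective V₁ V₂ E₁ E₂ conn₁ conn₂ bits≡) conn₂
    where
    same-edges : ∀ {E} → E₁ ≡ E → IsConnectedSubgraph G (V₂ , E) → (V₁ , E₁) ≡ (V₂ , E)
    same-edges refl conn₂′ = cong (_, E₁) (SubsetP.⊆-antisym
      (vertices-determined V₁ V₂ E₁ conn₁ conn₂′ bits≢0) (vertices-determined V₂ V₁ E₁ conn₂′ conn₁ bits≢0))

  edgeless-determine : ∀ V₁ V₂ E₁ E₂ → IsConnectedSubgraph G (V₁ , E₁) → IsConnectedSubgraph G (V₂ , E₂) →
    Edgeless E₁ → Edgeless E₂ → ∀ {x} → x ∈ V₁ → x ∈ V₂ → (V₁ , E₁) ≡ (V₂ , E₂)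
  edgeless-determine V₁ V₂ E₁ E₂ conn₁ conn₂ E₁-edgeless E₂-edgeless x∈V₁ x∈V₂ =
    cong₂ _,_ (SubsetP.⊆-antisym
                (λ u∈V₁ → subst (_∈ V₂) (sym (C₁.edgeless⇒single E₁-edgeless u∈V₁ x∈V₁)) x∈V₂)
                (λ u∈V₂ → subst (_∈ V₁) (sym (C₂.edgeless⇒single E₂-edgeless u∈V₂ x∈V₂)) x∈V₁))
              (edgeless-unique E₁-edgeless E₂-edgeless)
    where
    module C₁ = Connected V₁ E₁ conn₁
    module C₂ = Connected V₂ E₂ conn₂

  -- Codes: edgeless subgraphs are coded by their vertex, with vertex 0 taking
  -- the code of the empty edge set; others by their edge bits.
  Code : Set
  Code = Fin (2 ^ #edges) ⊎ Fin n′

  vertexCode : Fin n → Code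
  vertexCode zero = inj₁ (encode (zeros #edges))
  vertexCode (suc i) = inj₂ i

  vertexCode-injective : ∀ x y → vertexCode x ≡ vertexCode y → x ≡ y
  vertexCode-injective zero zero _ = refl
  vertexCode-injective (suc x) (suc y) refl = refl

  vertexCode≢edgeCode : ∀ x (b : Vec Bool #edges) → b ≢ zeros #edges → vertexCode x ≢ inj₁ (encode b)
  vertexCode≢edgeCode zero b b≢0 eq = b≢0 (sym (encode-injective _ _ (Data.Sum.Properties.inj₁-injective eq)))
  vertexCode≢edgeCode (suc x) b b≢0 ()

  code : (s : SubgraphData n) → IsConnectedSubgraph G s → Code
  code (V , E) conn with VecP.≡-dec BoolP._≟_ (edgeBits E) (zeros #edges)
  ... | yes _ = vertexCode (proj₁ (Connected.V-nonempty V E conn))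
  ... | no _ = inj₁ (encode (edgeBits E))

  code-injective : ∀ s₁ s₂ conn₁ conn₂ → code s₁ conn₁ ≡ code s₂ conn₂ → s₁ ≡ s₂
  code-injective (V₁ , E₁) (V₂ , E₂) conn₁ conn₂ eq
    with VecP.≡-dec BoolP._≟_ (edgeBits E₁) (zeros #edges) | VecP.≡-dec BoolP._≟_ (edgeBits E₂) (zeros #edges)
  ... | yes bits₁≡0 | yes bits₂≡0 =
    edgeless-determine V₁ V₂ E₁ E₂ conn₁ conn₂ (C₁.zeros⇒edgeless bits₁≡0) (C₂.zeros⇒edgeless bits₂≡0)
      (proj₂ C₁.V-nonempty)
      (subst (_∈ V₂) (sym (vertexCode-injective _ _ eq)) (proj₂ C₂.V-nonempty))
    where
    module C₁ = Connected V₁ E₁ conn₁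
    module C₂ = Connected V₂ E₂ conn₂
  ... | yes _ | no bits₂≢0 = ⊥-elim (vertexCode≢edgeCode _ _ bits₂≢0 eq)
  ... | no bits₁≢0 | yes _ = ⊥-elim (vertexCode≢edgeCode _ _ bits₁≢0 (sym eq))
  ... | no bits₁≢0 | no _ = edgeBits-determine V₁ V₂ E₁ E₂ conn₁ conn₂ bits₁≢0
    (encode-injective _ _ (Data.Sum.Properties.inj₁-injective eq))

  code-edgeBits : ∀ V E (conn : IsConnectedSubgraph G (V , E)) (b : Vec Bool #edges) → b ≢ zeros #edges →
    code (V , E) conn ≡ inj₁ (encode b) → edgeBits E ≡ b
  code-edgeBits V E conn b b≢0 eq with VecP.≡-dec BoolP._≟_ (edgeBits E) (zeros #edges)
  ... | yes _ = ⊥-elim (vertexCode≢edgeCode _ b b≢0 eq)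
  ... | no _ = encode-injective _ _ (Data.Sum.Properties.inj₁-injective eq)

  flatCode : (s : SubgraphData n) → IsConnectedSubgraph G s → Fin (2 ^ #edges + n′)
  flatCode s conn = Fin.join (2 ^ #edges) n′ (code s conn)

  flatCode-injective : ∀ s₁ s₂ conn₁ conn₂ → flatCode s₁ conn₁ ≡ flatCode s₂ conn₂ → s₁ ≡ s₂
  flatCode-injective s₁ s₂ conn₁ conn₂ eq =
    code-injective s₁ s₂ conn₁ conn₂ (join-injective (2 ^ #edges) n′ eq)

  core-≤ : ∀ {m} → CoreIndex G m → m ≤ 2 ^ #edges + n′
  core-≤ core = size-≤ core flatCode flatCode-injective

  upper-bound : ∀ {k m} → Acyclic G → NumComponents G k → CoreIndex G m → m ≤ 2 ^ (n ∸ k) + n′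
  upper-bound acyclic components core =
    ℕP.≤-trans (core-≤ core) (ℕP.+-monoˡ-≤ n′ (ℕP.^-monoʳ-≤ 2 (#edges≤n∸k acyclic components)))

module Centre {n′ : ℕ} (G : Graph (suc n′)) (G-simple : IsSimple G) where
  open SimpleGraph G G-simple

  _∈ₑ_ : Fin (suc n′) → Edge (suc n′) → Set
  x ∈ₑ (a , b) = x ≡ a ⊎ x ≡ b

  _∈ₑ?_ : ∀ x p → Dec (x ∈ₑ p)
  x ∈ₑ? (a , b) = (x Fin.≟ a) ⊎-dec (x Fin.≟ b)

  ∈ₑ-swap : ∀ {x a b} → x ∈ₑ (a , b) → x ∈ₑ (b , a)
  ∈ₑ-swap (inj₁ x≡a) = inj₂ x≡a
  ∈ₑ-swap (inj₂ x≡b) = inj₁ x≡b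

  Meet : Edge (suc n′) → Edge (suc n′) → Set
  Meet p q = ∃ λ t → t ∈ₑ p × t ∈ₑ q

  meet-swapˡ : ∀ {a b q} → Meet (b , a) q → Meet (a , b) q
  meet-swapˡ (t , t∈ , t∈q) = t , ∈ₑ-swap t∈ , t∈q

  meet-swapʳ : ∀ {p a b} → Meet p (b , a) → Meet p (a , b)
  meet-swapʳ (t , t∈p , t∈) = t , t∈p , ∈ₑ-swap t∈

  IsCentre : Fin (suc n′) → Set
  IsCentre c = ∀ u v → G u v ≡ true → u ≡ c ⊎ v ≡ c

  triangle⇒cycle : ∀ {a b s} → G a b ≡ true → G b s ≡ true → G s a ≡ true →
    a ≢ b → b ≢ s → s ≢ a → Cycle G
  triangle⇒cycle {a} {b} {s} ab bs sa a≢b b≢s s≢a = 0 , corner , (λ {i} {j} → corner-injective i j) , side , sa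
    where
    corner : Fin 3 → Fin (suc n′)
    corner zero = a
    corner (suc zero) = b
    corner (suc (suc zero)) = s
    corner-injective : ∀ i j → corner i ≡ corner j → i ≡ j
    corner-injective zero zero _ = refl
    corner-injective zero (suc zero) eq = ⊥-elim (a≢b eq)
    corner-injective zero (suc (suc zero)) eq = ⊥-elim (s≢a (sym eq))
    corner-injective (suc zero) zero eq = ⊥-elim (a≢b (sym eq))
    corner-injective (suc zero) (suc zero) _ = refl
    corner-injective (suc zero) (suc (suc zero)) eq = ⊥-elim (b≢s eq)
    corner-injective (suc (suc zero)) zero eq = ⊥-elim (s≢a eq)
    corner-injective (suc (suc zero)) (suc zero) eq = ⊥-elim (b≢s (sym eq))
    corner-injective (suc (suc zero)) (suc (suc zero)) _ = refl
    side : ∀ (i : Fin 2) → G (corner (inject₁ i)) (corner (suc i)) ≡ true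
    side zero = ab
    side (suc zero) = bs

  endpoints-adjacent : ∀ {x y s t} → G x y ≡ true → s ∈ₑ (x , y) → t ∈ₑ (x , y) → s ≢ t → G s t ≡ true
  endpoints-adjacent xy (inj₁ refl) (inj₁ refl) s≢t = ⊥-elim (s≢t refl)
  endpoints-adjacent xy (inj₁ refl) (inj₂ refl) _ = xy
  endpoints-adjacent {x} {y} xy (inj₂ refl) (inj₁ refl) _ = trans (G-symmetric y x) xy
  endpoints-adjacent xy (inj₂ refl) (inj₂ refl) s≢t = ⊥-elim (s≢t refl)

  PairwiseMeet : Set
  PairwiseMeet = ∀ {a b c d} → G a b ≡ true → G c d ≡ true → Meet (a , b) (c , d)

  -- If the edges of an acyclic G pairwise meet, ab is an edge and some edge cd
  -- avoids a, then b is a centre: an edge uv avoiding b contains a (it meets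
  -- ab) and meets cd in some s ∉ {a, b}, while b ∈ cd; so a, b, s is a triangle.
  far-end-is-centre : Acyclic G → PairwiseMeet → ∀ {a b c d} → G a b ≡ true → G c d ≡ true →
    ¬ (a ∈ₑ (c , d)) → IsCentre b
  far-end-is-centre acyclic meet {a} {b} {c} {d} ab cd a∉cd u v uv with u Fin.≟ b | v Fin.≟ b
  ... | yes u≡b | _ = inj₁ u≡b
  ... | no _ | yes v≡b = inj₂ v≡b
  ... | no u≢b | no v≢b = ⊥-elim (acyclic (triangle⇒cycle ab bs sa (adjacent⇒≢ ab) b≢s s≢a))
    where
    not-b : ∀ {x} → x ∈ₑ (u , v) → x ≢ b
    not-b (inj₁ refl) = u≢b
    not-b (inj₂ refl) = v≢b
    a∈uv : a ∈ₑ (u , v)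
    a∈uv with meet ab uv
    ... | t , inj₁ refl , t∈uv = t∈uv
    ... | t , inj₂ refl , t∈uv = ⊥-elim (not-b t∈uv refl)
    b∈cd : b ∈ₑ (c , d)
    b∈cd with meet ab cd
    ... | t , inj₁ refl , t∈cd = ⊥-elim (a∉cd t∈cd)
    ... | t , inj₂ refl , t∈cd = t∈cd
    s : Fin (suc n′)
    s = proj₁ (meet uv cd)
    s∈uv : s ∈ₑ (u , v)
    s∈uv = proj₁ (proj₂ (meet uv cd))
    s∈cd : s ∈ₑ (c , d)
    s∈cd = proj₂ (proj₂ (meet uv cd))
    b≢s : b ≢ s
    b≢s b≡s = not-b s∈uv (sym b≡s)
    s≢a : s ≢ a
    s≢a s≡a = a∉cd (subst (_∈ₑ (c , d)) s≡a s∈cd)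
    bs : G b s ≡ true
    bs = endpoints-adjacent cd b∈cd s∈cd b≢s
    sa : G s a ≡ true
    sa = endpoints-adjacent uv s∈uv a∈uv s≢a

  -- If the edges of an acyclic G pairwise meet, G has a centre: with no edges
  -- any vertex is one; otherwise take an edge ab, and either every edge
  -- contains a, or some edge avoids a and b is a centre.
  centre : Acyclic G → PairwiseMeet → ∃ IsCentre
  centre acyclic meet with FinP.any? (λ a → FinP.any? (λ b → G a b BoolP.≟ true))
  ... | no no-edge = zero , λ u v uv → ⊥-elim (no-edge (u , v , uv))
  ... | yes (a , b , ab) with FinP.any? (λ u → FinP.any? (λ v → (G u v BoolP.≟ true) ×-dec ¬? (a ∈ₑ? (u , v))))
  ...   | yes (c , d , cd , a∉cd) = b , far-end-is-centre acyclic meet ab cd a∉cd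
  ...   | no none = a , a-centre
    where
    a-centre : IsCentre a
    a-centre u v uv with decidable-stable (a ∈ₑ? (u , v)) (λ a∉uv → none (u , v , uv , a∉uv))
    ... | inj₁ a≡u = inj₁ (sym a≡u)
    ... | inj₂ a≡v = inj₂ (sym a≡v)

  centre-adjacency : ∀ {c} → IsCentre c → ∀ i j → G i j ≡ (i == c ∧ G c j) ∨ (j == c ∧ G c i)
  centre-adjacency {c} c-centre i j with i Fin.≟ c | j Fin.≟ c
  ... | yes refl | yes refl rewrite G-loopless c = refl
  ... | yes refl | no _ = sym (BoolP.∨-identityʳ (G c j))
  ... | no _ | yes refl = G-symmetric i c
  ... | no i≢c | no j≢c = ¬true⇒false λ ij → case (c-centre i j ij)
    where
    case : i ≡ c ⊎ j ≡ c → ⊥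
    case (inj₁ i≡c) = i≢c i≡c
    case (inj₂ j≡c) = j≢c j≡c

  isOther : Fin (suc n′) → Fin (suc n′) → Bool
  isOther c v = not (v == c) ∧ not (G c v)

  other-isolated : ∀ {c} → IsCentre c → ∀ {a} → isOther c a ≡ true → ∀ w → ¬ (G a w ≡ true)
  other-isolated {c} c-centre {a} other-a w aw with ∧-elim {not (a == c)} other-a | c-centre a w aw
  ... | a≢c , _ | inj₁ refl = true≢false (trans (sym (==-refl c)) (not-true a≢c))
  ... | _ , a≁c | inj₂ refl = true≢false (trans (sym aw) (trans (G-symmetric a c) (not-true a≁c)))

  other-walk : ∀ {c} → IsCentre c → ∀ {a b} → isOther c a ≡ true → Walk G a b → a ≡ b
  other-walk c-centre other-a here = refl
  other-walk c-centre other-a (step aw _) = ⊥-elim (other-isolated c-centre other-a _ aw)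

-- The star forest (k-1)K₁ ∪ K_{1,n-k} marks vertex k-1 as the centre and the
-- vertices ≥ k as its leaves; starForest n k i j unfolds to
-- (isCentreIndex k i ∧ isLeafIndex k j) ∨ (isCentreIndex k j ∧ isLeafIndex k i).

isCentreIndex : ℕ → ∀ {n} → Fin n → Bool
isCentreIndex k x = suc (toℕ x) ≡ᵇ k

isLeafIndex : ℕ → ∀ {n} → Fin n → Bool
isLeafIndex k x = k ≤ᵇ toℕ x

≡ᵇ-refl : ∀ a → (a ≡ᵇ a) ≡ true
≡ᵇ-refl a = Equivalence.to BoolP.T-≡ (ℕP.≡⇒≡ᵇ a a refl)

≡ᵇ⇒≡ : ∀ a b → (a ≡ᵇ b) ≡ true → a ≡ b
≡ᵇ⇒≡ a b a≡ᵇb = ℕP.≡ᵇ⇒≡ a b (Equivalence.from BoolP.T-≡ a≡ᵇb)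

≢⇒≡ᵇ-false : ∀ {a b} → a ≢ b → (a ≡ᵇ b) ≡ false
≢⇒≡ᵇ-false {a} {b} a≢b = ¬true⇒false λ a≡ᵇb → a≢b (≡ᵇ⇒≡ a b a≡ᵇb)

≤⇒≤ᵇ-true : ∀ {a b} → a ≤ b → (a ≤ᵇ b) ≡ true
≤⇒≤ᵇ-true a≤b = Equivalence.to BoolP.T-≡ (ℕP.≤⇒≤ᵇ a≤b)

>⇒≤ᵇ-false : ∀ {a b} → b < a → (a ≤ᵇ b) ≡ false
>⇒≤ᵇ-false {a} {b} b<a = ¬true⇒false λ a≤ᵇb →
  ℕP.<⇒≱ b<a (ℕP.≤ᵇ⇒≤ a b (Equivalence.from BoolP.T-≡ a≤ᵇb))

-- A simple graph with a centre c, at most n - k neighbours of c and at most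
-- k - 1 other vertices is isomorphic to the star forest: number the other
-- vertices 0 .. k-2, the centre k-1 and the leaves k .. n-1.

module StarShape {n′ k′ : ℕ} (G : Graph (suc n′)) (G-simple : IsSimple G) (k≤n : suc k′ ≤ suc n′)
    {c : Fin (suc n′)} (c-centre : Centre.IsCentre G G-simple c)
    (others-< : suc (count (Centre.isOther G G-simple c)) ≤ suc k′)
    (leaves-≤ : count (G c) ≤ suc n′ ∸ suc k′) where
  open SimpleGraph G G-simple
  open Centre G G-simple

  n k : ℕ
  n = suc n′
  k = suc k′

  data Role (v : Fin n) : Set where
    centre-role : v ≡ c → Role v
    leaf-role : G c v ≡ true → Role v
    other-role : isOther c v ≡ true → Role v

  role : ∀ v → Role v
  role v with v Fin.≟ c | G c v in cv
  ... | yes v≡c | _ = centre-role v≡c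
  ... | no _ | true = leaf-role cv
  ... | no v≢c | false = other-role (cong₂ _∧_ (cong not (≢⇒==-false v≢c)) (cong not cv))

  position : ∀ v → Role v → ℕ
  position v (centre-role _) = k′
  position v (leaf-role _) = k + rank (G c) v
  position v (other-role _) = rank (isOther c) v

  other-below : ∀ {v} → isOther c v ≡ true → rank (isOther c) v < k′
  other-below other-v = ℕP.<-≤-trans (rank-<-count (isOther c) _ other-v) (ℕP.≤-pred others-<)

  position-< : ∀ v r → position v r < n
  position-< v (centre-role _) = k≤n
  position-< v (leaf-role cv) = begin-strict
    k + rank (G c) v  <⟨ ℕP.+-monoʳ-< k (rank-<-count (G c) v cv) ⟩
    k + count (G c)   ≤⟨ ℕP.+-monoʳ-≤ k leaves-≤ ⟩
    k + (n ∸ k)       ≡⟨ ℕP.m+[n∸m]≡n k≤n ⟩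
    n                 ∎
    where open ℕP.≤-Reasoning
  position-< v (other-role other-v) = ℕP.<-trans (other-below other-v) (ℕP.<-≤-trans (ℕP.n<1+n k′) k≤n)

  leaf-above : ∀ v → k′ < k + rank (G c) v
  leaf-above v = ℕP.<-≤-trans (ℕP.n<1+n k′) (ℕP.m≤m+n k _)

  position-injective : ∀ v w rv rw → position v rv ≡ position w rw → v ≡ w
  position-injective v w (centre-role v≡c) (centre-role w≡c) _ = trans v≡c (sym w≡c)
  position-injective v w (leaf-role cv) (leaf-role cw) eq = rank-injective (G c) v w cv cw (ℕP.+-cancelˡ-≡ k _ _ eq)
  position-injective v w (other-role ov) (other-role ow) eq = rank-injective (isOther c) v w ov ow eq
  position-injective v w (centre-role _) (leaf-role _) eq = ⊥-elim (ℕP.<-irrefl eq (leaf-above w))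
  position-injective v w (leaf-role _) (centre-role _) eq = ⊥-elim (ℕP.<-irrefl (sym eq) (leaf-above v))
  position-injective v w (centre-role _) (other-role ow) eq = ⊥-elim (ℕP.<-irrefl (sym eq) (other-below ow))
  position-injective v w (other-role ov) (centre-role _) eq = ⊥-elim (ℕP.<-irrefl eq (other-below ov))
  position-injective v w (leaf-role _) (other-role ow) eq =
    ⊥-elim (ℕP.<-irrefl (sym eq) (ℕP.<-trans (other-below ow) (leaf-above v)))
  position-injective v w (other-role ov) (leaf-role _) eq =
    ⊥-elim (ℕP.<-irrefl eq (ℕP.<-trans (other-below ov) (leaf-above w)))

  centre-index : ∀ v r → (suc (position v r) ≡ᵇ k) ≡ v == c
  centre-index v (centre-role refl) = trans (≡ᵇ-refl k) (sym (==-refl c))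
  centre-index v (leaf-role cv) =
    trans (≢⇒≡ᵇ-false (λ eq → ℕP.<-irrefl (sym (ℕP.suc-injective eq)) (leaf-above v)))
          (sym (≢⇒==-false (λ v≡c → adjacent⇒≢ cv (sym v≡c))))
  centre-index v (other-role ov) =
    trans (≢⇒≡ᵇ-false (λ eq → ℕP.<-irrefl (ℕP.suc-injective eq) (other-below ov)))
          (sym (not-true (proj₁ (∧-elim {not (v == c)} ov))))

  leaf-index : ∀ v r → (k ≤ᵇ position v r) ≡ G c v
  leaf-index v (centre-role refl) = trans (>⇒≤ᵇ-false (ℕP.n<1+n k′)) (sym (G-loopless c))
  leaf-index v (leaf-role cv) = trans (≤⇒≤ᵇ-true (ℕP.m≤m+n k _)) (sym cv)
  leaf-index v (other-role ov) =
    trans (>⇒≤ᵇ-false (ℕP.<-trans (other-below ov) (ℕP.n<1+n k′)))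
          (sym (not-true (proj₂ (∧-elim {not (v == c)} ov))))

  σ : Fin n → Fin n
  σ v = fromℕ< (position-< v (role v))

  toℕ-σ : ∀ v → toℕ (σ v) ≡ position v (role v)
  toℕ-σ v = FinP.toℕ-fromℕ< (position-< v (role v))

  σ-injective : Injective _≡_ _≡_ σ
  σ-injective {v} {w} eq =
    position-injective v w (role v) (role w) (trans (sym (toℕ-σ v)) (trans (cong toℕ eq) (toℕ-σ w)))

  σ-adjacency : ∀ i j → G i j ≡ starForest n k (σ i) (σ j)
  σ-adjacency i j = trans (centre-adjacency c-centre i j)
    (sym (cong₂ _∨_ (cong₂ _∧_ (centre-index′ i) (leaf-index′ j)) (cong₂ _∧_ (centre-index′ j) (leaf-index′ i))))
    where
    centre-index′ : ∀ v → isCentreIndex k (σ v) ≡ v == c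
    centre-index′ v = trans (cong (λ p → suc p ≡ᵇ k) (toℕ-σ v)) (centre-index v (role v))
    leaf-index′ : ∀ v → isLeafIndex k (σ v) ≡ G c v
    leaf-index′ v = trans (cong (k ≤ᵇ_) (toℕ-σ v)) (leaf-index v (role v))

  isomorphic : G ≅ starForest n k
  isomorphic = mk↔ₛ′ σ σ⁻¹ (λ y → proj₂ (onto y)) (λ x → σ-injective (proj₂ (onto (σ x)))) , σ-adjacency
    where
    onto : ∀ y → ∃ λ x → σ x ≡ y
    onto = injective⇒surjective σ σ-injective ℕP.≤-refl
    σ⁻¹ : Fin n → Fin n
    σ⁻¹ y = proj₁ (onto y)

module Extremal {n′ k′ : ℕ} (G : Graph (suc n′)) (G-simple : IsSimple G) (k≤n : suc k′ ≤ suc n′)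
    (acyclic : Acyclic G) (components : NumComponents G (suc k′))
    {m : ℕ} (core : CoreIndex G m) (extremal : m ≡ 2 ^ (n′ ∸ k′) + n′) where
  open Coding G G-simple
  open Centre G G-simple

  k : ℕ
  k = suc k′

  n∸k≤#edges : n ∸ k ≤ #edges
  n∸k≤#edges = ℕP.≮⇒≥ λ #edges<n∸k →
    ℕP.<⇒≱ (ℕP.+-monoˡ-< n′ (ℕP.^-monoʳ-< 2 (s≤s (s≤s z≤n)) #edges<n∸k))
            (subst (_≤ 2 ^ #edges + n′) extremal (core-≤ core))

  codes≤core : 2 ^ #edges + n′ ≤ m
  codes≤core = subst (2 ^ #edges + n′ ≤_) (sym extremal) (ℕP.+-monoˡ-≤ n′ (ℕP.^-monoʳ-≤ 2 (#edges≤n∸k acyclic components)))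

  -- Hence the coding is onto: every nonzero edge bit vector is the edge set
  -- of a connected subgraph.
  realise : ∀ (b : Vec Bool #edges) → b ≢ zeros #edges →
    ∃ λ V → ∃ λ E → IsConnectedSubgraph G (V , E) × edgeBits E ≡ b
  realise b b≢0 = proj₁ s , proj₂ s , s-connected ,
                  code-edgeBits (proj₁ s) (proj₂ s) s-connected b b≢0 (join-injective (2 ^ #edges) n′ (proj₂ hit))
    where
    enum : Fin m → SubgraphData n
    enum = proj₁ core
    enum-connected : ∀ i → IsConnectedSubgraph G (enum i)
    enum-connected = proj₁ (proj₂ (proj₂ core))
    codeOf : Fin m → Fin (2 ^ #edges + n′)
    codeOf i = flatCode (enum i) (enum-connected i)
    codeOf-injective : Injective _≡_ _≡_ codeOf
    codeOf-injective {i} {j} eq = proj₁ (proj₂ core) (flatCode-injective (enum i) (enum j) _ _ eq)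
    hit : ∃ λ i → codeOf i ≡ Fin.join (2 ^ #edges) n′ (inj₁ (encode b))
    hit = injective⇒surjective codeOf codeOf-injective codes≤core (Fin.join (2 ^ #edges) n′ (inj₁ (encode b)))
    s : SubgraphData n
    s = enum (proj₁ hit)
    s-connected : IsConnectedSubgraph G s
    s-connected = enum-connected (proj₁ hit)

  -- Two listed edges p, q meet: realise the edge set {p, q}; a walk inside it
  -- from an end of p to an end of q can only leave p through a vertex of q.
  listed-meet : ∀ {p q} → p ∈ₗ edges → q ∈ₗ edges → Meet p q
  listed-meet {p@(a , b)} {q@(c , d)} p∈ q∈ = conclude (walk-stays (inj₁ refl) (C.V-connected a c a∈V c∈V))
    where
    inPair : Edge n → Bool
    inPair r = does (r ≟ₑ p) ∨ does (r ≟ₑ q)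
    inPair-p : inPair p ≡ true
    inPair-p = ∨-introˡ (does (p ≟ₑ q)) (dec-true (p ≟ₑ p) refl)
    inPair-q : inPair q ≡ true
    inPair-q = ∨-introʳ (does (q ≟ₑ p)) (dec-true (q ≟ₑ q) refl)
    inPair⁻ : ∀ r → inPair r ≡ true → r ≡ p ⊎ r ≡ q
    inPair⁻ r r∈ with r ≟ₑ p | r ≟ₑ q
    ... | yes r≡p | _ = inj₁ r≡p
    ... | no _ | yes r≡q = inj₂ r≡q
    realised : ∃ λ V → ∃ λ E → IsConnectedSubgraph G (V , E) × edgeBits E ≡ indicatorVec inPair edges
    realised = realise (indicatorVec inPair edges)
                 (λ bits≡0 → true≢false (trans (sym inPair-p) (indicatorVec-zeros⁻ edges bits≡0 p∈)))
    V : Subset n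
    V = proj₁ realised
    E : Vec (Subset n) n
    E = proj₁ (proj₂ realised)
    module C = Coding.Connected G G-simple V E (proj₁ (proj₂ (proj₂ realised)))
    E≡inPair : ∀ {r} → r ∈ₗ edges → edgeOf E (proj₁ r) (proj₂ r) ≡ inPair r
    E≡inPair r∈ = indicatorVec-≡ edges r∈ (proj₂ (proj₂ (proj₂ realised)))
    a∈V : a ∈ V
    a∈V = proj₁ (proj₂ (C.E-sub a b (trans (E≡inPair p∈) inPair-p)))
    c∈V : c ∈ V
    c∈V = proj₁ (proj₂ (C.E-sub c d (trans (E≡inPair q∈) inPair-q)))
    leaving : ∀ {x y} → x ∈ₑ p → (x , y) ≡ p ⊎ (x , y) ≡ q → y ∈ₑ p ⊎ Meet p q
    leaving x∈p (inj₁ xy≡p) = inj₁ (inj₂ (cong proj₂ xy≡p))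
    leaving {x} x∈p (inj₂ xy≡q) = inj₂ (x , x∈p , inj₁ (cong proj₁ xy≡q))
    leaving′ : ∀ {x y} → x ∈ₑ p → (y , x) ≡ p ⊎ (y , x) ≡ q → y ∈ₑ p ⊎ Meet p q
    leaving′ x∈p (inj₁ yx≡p) = inj₁ (inj₁ (cong proj₁ yx≡p))
    leaving′ {x} x∈p (inj₂ yx≡q) = inj₂ (x , x∈p , inj₂ (cong proj₂ yx≡q))
    step-stays : ∀ {x y} → x ∈ₑ p → edgeOf E x y ≡ true → y ∈ₑ p ⊎ Meet p q
    step-stays {x} {y} x∈p xy∈E = by-listing (C.E-listed xy∈E)
      where
      by-listing : (x , y) ∈ₗ edges ⊎ (y , x) ∈ₗ edges → y ∈ₑ p ⊎ Meet p q
      by-listing (inj₁ xy∈) = leaving x∈p (inPair⁻ (x , y) (trans (sym (E≡inPair xy∈)) xy∈E))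
      by-listing (inj₂ yx∈) =
        leaving′ x∈p (inPair⁻ (y , x) (trans (sym (E≡inPair yx∈)) (trans (C.E-symmetric y x) xy∈E)))
    walk-stays : ∀ {x y} → x ∈ₑ p → Walk (edgeOf E) x y → y ∈ₑ p ⊎ Meet p q
    walk-stays x∈p here = inj₁ x∈p
    walk-stays x∈p (step xw∈E walk) = [ (λ w∈p → walk-stays w∈p walk) , inj₂ ]′ (step-stays x∈p xw∈E)
    conclude : c ∈ₑ p ⊎ Meet p q → Meet p q
    conclude (inj₁ c∈p) = c , c∈p , inj₁ refl
    conclude (inj₂ meet) = meet

  edges-meet : PairwiseMeet
  edges-meet ab cd = by-listing (edge-listed ab) (edge-listed cd)
    where
    by-listing : ∀ {a b c d} → (a , b) ∈ₗ edges ⊎ (b , a) ∈ₗ edges → (c , d) ∈ₗ edges ⊎ (d , c) ∈ₗ edges →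
      Meet (a , b) (c , d)
    by-listing (inj₁ ab∈) (inj₁ cd∈) = listed-meet ab∈ cd∈
    by-listing (inj₁ ab∈) (inj₂ dc∈) = meet-swapʳ (listed-meet ab∈ dc∈)
    by-listing (inj₂ ba∈) (inj₁ cd∈) = meet-swapˡ (listed-meet ba∈ cd∈)
    by-listing (inj₂ ba∈) (inj₂ dc∈) = meet-swapˡ (meet-swapʳ (listed-meet ba∈ dc∈))

  -- The centre is kept opaque: only its defining property is ever used.
  opaque
    c : Fin n
    c = proj₁ (centre acyclic edges-meet)

    c-centre : IsCentre c
    c-centre = proj₂ (centre acyclic edges-meet)

  -- There are at most k - 1 other vertices: with c they form a separated set,
  -- so by the forest bound count + 1 + e ≤ n, and e = n - k.
  others-< : suc (count (isOther c)) ≤ k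
  others-< = ℕP.+-cancelʳ-≤ (n ∸ k) (suc (count (isOther c))) k (begin
    suc (count (isOther c)) + (n ∸ k)  ≤⟨ ℕP.+-monoʳ-≤ (suc (count (isOther c))) n∸k≤#edges ⟩
    suc (count (isOther c)) + #edges   ≡⟨ cong (_+ #edges) (sym (count-insert (isOther c) c other-c≡false)) ⟩
    count rootOrOther + #edges         ≤⟨ forest-bound-G acyclic rootOrOther separated ⟩
    n                                  ≡⟨ sym (ℕP.m+[n∸m]≡n k≤n) ⟩
    k + (n ∸ k)                        ∎)
    where
    open ℕP.≤-Reasoning
    other-c≡false : isOther c c ≡ false
    other-c≡false rewrite ==-refl c = refl
    rootOrOther : Fin n → Bool
    rootOrOther x = isOther c x ∨ x == c
    separated : Separated rootOrOther (graphOf edges)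
    separated a b a∈ b∈ walk with ∨-elim {isOther c a} a∈ | ∨-elim {isOther c b} b∈
    ... | inj₁ other-a | _ = other-walk c-centre other-a (walk-map listed⊆G walk)
    ... | inj₂ a≡c | inj₁ other-b = sym (other-walk c-centre other-b (reverseʷ G-symmetric (walk-map listed⊆G walk)))
    ... | inj₂ a≡c | inj₂ b≡c = trans (==⇒≡ {x = a} {c} a≡c) (sym (==⇒≡ {x = b} {c} b≡c))

  leaves-≤ : count (G c) ≤ n ∸ k
  leaves-≤ = ℕP.≤-trans (degree-≤ c) (#edges≤n∸k acyclic components)

  isomorphic : G ≅ starForest n k
  isomorphic = StarShape.isomorphic G G-simple k≤n c-centre others-< leaves-≤

single : ∀ {n} → Fin n → SubgraphData n
single x = tabulate (_== x) , tabulate (λ _ → tabulate (λ _ → false))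

single-∈ : ∀ {n} (x : Fin n) {u} → u ∈ proj₁ (single x) → u ≡ x
single-∈ x u∈ = ==⇒≡ (∈-tabulate (_== x) u∈)

single-connected : ∀ {n} (G : Graph n) x → IsConnectedSubgraph G (single x)
single-connected G x =
  (λ u v → trans (no-edge u v) (sym (no-edge v u))) ,
  (λ u v uv → ⊥-elim (true≢false (trans (sym uv) (no-edge u v)))) ,
  (x , tabulate-∈ (_== x) (==-refl x)) ,
  λ u v u∈ v∈ → subst (Walk _ u) (trans (single-∈ x u∈) (sym (single-∈ x v∈))) here
  where
  no-edge : ∀ u v → edgeOf (proj₂ (single x)) u v ≡ false
  no-edge = edgeOf-tabulate (λ _ _ → false)

single-injective : ∀ {n} (x y : Fin n) → single x ≡ single y → x ≡ y
single-injective x y eq = single-∈ y (subst (λ s → x ∈ proj₁ s) eq (tabulate-∈ (_== x) (==-refl x)))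

-- Reading a bit vector at a natural-number position (false when out of range).

bitAt : ∀ {e} → Vec Bool e → ℕ → Bool
bitAt [] _ = false
bitAt (b ∷ bs) zero = b
bitAt (b ∷ bs) (suc t) = bitAt bs t

bitAt-ext : ∀ {e} (b b′ : Vec Bool e) → (∀ t → t < e → bitAt b t ≡ bitAt b′ t) → b ≡ b′
bitAt-ext [] [] _ = refl
bitAt-ext (x ∷ b) (y ∷ b′) agree = cong₂ _∷_ (agree 0 (s≤s z≤n)) (bitAt-ext b b′ (λ t t< → agree (suc t) (s≤s t<)))

-- The star forest has at least 2^(n-k) + n - 1 connected subgraphs: the
-- stars at the centre with any set of leaves (the empty one being the centre
-- alone), and the single vertices other than the centre.

module StarForestSubgraphs {n′ k′ : ℕ} (G : Graph (suc n′)) (k≤n : suc k′ ≤ suc n′)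
    (iso : G ≅ starForest (suc n′) (suc k′)) where
  n k e : ℕ
  n = suc n′
  k = suc k′
  e = n ∸ k

  σ τ : Fin n → Fin n
  σ = Inverse.to (proj₁ iso)
  τ = Inverse.from (proj₁ iso)

  σ∘τ : ∀ y → σ (τ y) ≡ y
  σ∘τ = Inverse.strictlyInverseˡ (proj₁ iso)

  τ∘σ : ∀ x → τ (σ x) ≡ x
  τ∘σ = Inverse.strictlyInverseʳ (proj₁ iso)

  isCentre isLeaf : Fin n → Bool
  isCentre v = isCentreIndex k (σ v)
  isLeaf v = isLeafIndex k (σ v)

  c : Fin n
  c = τ (fromℕ< k≤n)

  toℕ-σ-c : toℕ (σ c) ≡ k′
  toℕ-σ-c = trans (cong toℕ (σ∘τ _)) (FinP.toℕ-fromℕ< k≤n)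

  c-isCentre : isCentre c ≡ true
  c-isCentre rewrite toℕ-σ-c = ≡ᵇ-refl k

  isCentre⇒c : ∀ {v} → isCentre v ≡ true → v ≡ c
  isCentre⇒c {v} cv = trans (sym (τ∘σ v)) (cong τ (FinP.toℕ-injective
    (trans (ℕP.suc-injective (≡ᵇ⇒≡ (suc (toℕ (σ v))) k cv)) (sym (FinP.toℕ-fromℕ< k≤n)))))

  -- star b: the centre joined to the leaves selected by b : Vec Bool e
  -- (leaf k + t is selected by bit t).  Every vertex of it reaches c.
  selected : Vec Bool e → Fin n → Bool
  selected b v = isLeaf v ∧ bitAt b (toℕ (σ v) ∸ k)

  starVertices : Vec Bool e → Fin n → Bool
  starVertices b v = isCentre v ∨ selected b v

  starEdges : Vec Bool e → Fin n → Fin n → Bool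
  starEdges b u v = (isCentre u ∧ selected b v) ∨ (isCentre v ∧ selected b u)

  star : Vec Bool e → SubgraphData n
  star b = tabulate (starVertices b) , tabulate (λ u → tabulate (starEdges b u))

  star-connected : ∀ b → IsConnectedSubgraph G (star b)
  star-connected b =
    star-symmetric ,
    (λ u v uv → edge-in-G u v (trans (sym (edgeOf-tabulate (starEdges b) u v)) uv)) ,
    (c , in-V (∨-introˡ (selected b c) c-isCentre)) ,
    λ u v u∈ v∈ → to-centre u (∈-tabulate (starVertices b) u∈)
                    ++ʷ reverseʷ star-symmetric (to-centre v (∈-tabulate (starVertices b) v∈))
    where
    E : Graph n
    E = edgeOf (proj₂ (star b))
    star-symmetric : IsSymmetric E
    star-symmetric u v = trans (edgeOf-tabulate (starEdges b) u v)
      (trans (BoolP.∨-comm (isCentre u ∧ selected b v) (isCentre v ∧ selected b u))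
             (sym (edgeOf-tabulate (starEdges b) v u)))
    in-V : ∀ {v} → starVertices b v ≡ true → v ∈ proj₁ (star b)
    in-V = tabulate-∈ (starVertices b)
    selected⇒leaf : ∀ {v} → selected b v ≡ true → isLeaf v ≡ true
    selected⇒leaf {v} sv = proj₁ (∧-elim {isLeaf v} sv)
    edge-in-G : ∀ u v → starEdges b u v ≡ true → G u v ≡ true × u ∈ proj₁ (star b) × v ∈ proj₁ (star b)
    edge-in-G u v uv with ∨-elim {isCentre u ∧ selected b v} uv
    ... | inj₁ cu∧sv with ∧-elim {isCentre u} cu∧sv
    ...   | cu , sv = trans (proj₂ iso u v) (∨-introˡ (isCentre v ∧ isLeaf u) (cong₂ _∧_ cu (selected⇒leaf sv))) ,
                      in-V (∨-introˡ (selected b u) cu) , in-V (∨-introʳ (isCentre v) sv)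
    edge-in-G u v uv | inj₂ cv∧su with ∧-elim {isCentre v} cv∧su
    ...   | cv , su = trans (proj₂ iso u v) (∨-introʳ (isCentre u ∧ isLeaf v) (cong₂ _∧_ cv (selected⇒leaf su))) ,
                      in-V (∨-introʳ (isCentre u) su) , in-V (∨-introˡ (selected b v) cv)
    to-centre : ∀ u → starVertices b u ≡ true → Walk E u c
    to-centre u u∈ with ∨-elim {isCentre u} u∈
    ... | inj₁ cu = subst (Walk E u) (isCentre⇒c cu) here
    ... | inj₂ su = step (trans (edgeOf-tabulate (starEdges b) u c)
                               (∨-introʳ (isCentre u ∧ selected b c) (cong₂ _∧_ c-isCentre su))) here

  leaf< : ∀ t → t < e → k + t < n
  leaf< t t<e = ℕP.<-≤-trans (ℕP.+-monoʳ-< k t<e) (ℕP.≤-reflexive (ℕP.m+[n∸m]≡n k≤n))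

  leaf : ∀ t → t < e → Fin n
  leaf t t<e = τ (fromℕ< (leaf< t t<e))

  toℕ-σ-leaf : ∀ t (t<e : t < e) → toℕ (σ (leaf t t<e)) ≡ k + t
  toℕ-σ-leaf t t<e = trans (cong toℕ (σ∘τ (fromℕ< (leaf< t t<e)))) (FinP.toℕ-fromℕ< (leaf< t t<e))

  star-edge : ∀ b t (t<e : t < e) → edgeOf (proj₂ (star b)) c (leaf t t<e) ≡ bitAt b t
  star-edge b t t<e = begin
    edgeOf (proj₂ (star b)) c ℓ
      ≡⟨ edgeOf-tabulate (starEdges b) c ℓ ⟩
    (isCentre c ∧ selected b ℓ) ∨ (isCentre ℓ ∧ selected b c)
      ≡⟨ cong₂ (λ x y → (x ∧ selected b ℓ) ∨ (y ∧ selected b c)) c-isCentre ℓ-not-centre ⟩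
    selected b ℓ ∨ false
      ≡⟨ BoolP.∨-identityʳ (selected b ℓ) ⟩
    isLeaf ℓ ∧ bitAt b (toℕ (σ ℓ) ∸ k)
      ≡⟨ cong₂ _∧_ ℓ-isLeaf (cong (λ i → bitAt b (i ∸ k)) (toℕ-σ-leaf t t<e)) ⟩
    bitAt b (k + t ∸ k)
      ≡⟨ cong (bitAt b) (ℕP.m+n∸m≡n k t) ⟩
    bitAt b t ∎
    where
    open ≡-Reasoning
    ℓ : Fin n
    ℓ = leaf t t<e
    ℓ-not-centre : isCentre ℓ ≡ false
    ℓ-not-centre rewrite toℕ-σ-leaf t t<e =
      ≢⇒≡ᵇ-false (λ eq → ℕP.<-irrefl (sym eq) (s≤s (ℕP.m≤m+n k t)))
    ℓ-isLeaf : isLeaf ℓ ≡ true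
    ℓ-isLeaf rewrite toℕ-σ-leaf t t<e = ≤⇒≤ᵇ-true (ℕP.m≤m+n k t)

  star-injective : ∀ b b′ → star b ≡ star b′ → b ≡ b′
  star-injective b b′ eq = bitAt-ext b b′ λ t t<e →
    trans (sym (star-edge b t t<e))
          (trans (cong (λ s → edgeOf (proj₂ s) c (leaf t t<e)) eq) (star-edge b′ t t<e))

  c∈star : ∀ b → c ∈ proj₁ (star b)
  c∈star b = tabulate-∈ (starVertices b) (∨-introˡ (selected b c) c-isCentre)

  subgraph : Fin (2 ^ e) ⊎ Fin n′ → SubgraphData n
  subgraph (inj₁ y) = star (decode y)
  subgraph (inj₂ i) = single (Fin.punchIn c i)

  subgraph-connected : ∀ z → IsConnectedSubgraph G (subgraph z)
  subgraph-connected (inj₁ y) = star-connected (decode y)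
  subgraph-connected (inj₂ i) = single-connected G (Fin.punchIn c i)

  star≢single : ∀ b i → star b ≢ single (Fin.punchIn c i)
  star≢single b i eq =
    FinP.punchInᵢ≢i c i (sym (single-∈ (Fin.punchIn c i) (subst (λ s → c ∈ proj₁ s) eq (c∈star b))))

  subgraph-injective : ∀ z z′ → subgraph z ≡ subgraph z′ → z ≡ z′
  subgraph-injective (inj₁ y) (inj₁ y′) eq = cong inj₁ (decode-injective y y′ (star-injective (decode y) (decode y′) eq))
  subgraph-injective (inj₁ y) (inj₂ i) eq = ⊥-elim (star≢single (decode y) i eq)
  subgraph-injective (inj₂ i) (inj₁ y) eq = ⊥-elim (star≢single (decode y) i (sym eq))
  subgraph-injective (inj₂ i) (inj₂ i′) eq =
    cong inj₂ (FinP.punchIn-injective c i i′ (single-injective (Fin.punchIn c i) (Fin.punchIn c i′) eq))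

  core-≥ : ∀ {m} → CoreIndex G m → 2 ^ e + n′ ≤ m
  core-≥ core = size-≥ core (subgraph ∘′ Fin.splitAt (2 ^ e))
    (λ {i} {j} eq → splitAt-injective (2 ^ e) n′ (subgraph-injective (Fin.splitAt (2 ^ e) i) (Fin.splitAt (2 ^ e) j) eq))
    (λ i → subgraph-connected (Fin.splitAt (2 ^ e) i))

theorem2p7 : (n k : ℕ) → 1 ≤ k → k ≤ n → (G : Graph n) → IsSimple G →
    Acyclic G → NumComponents G k → (m : ℕ) → CoreIndex G m →
    (m ≤ 2 ^ (n ∸ k) + (n ∸ 1)) × ((m ≡ 2 ^ (n ∸ k) + (n ∸ 1)) ⇔ (G ≅ starForest n k))
-- The bound is Coding.upper-bound; equality gives the star forest by
-- Extremal, and the star forest attains the bound by StarForestSubgraphs.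
-- (n = 0 is excluded by 1 ≤ k ≤ n.)
theorem2p7 zero (suc k′) _ () _ _ _ _ _ _
theorem2p7 (suc n′) (suc k′) _ k≤n G simple acyclic components m core =
  upper , mk⇔ extremal⇒star star⇒extremal
  where
  upper : m ≤ 2 ^ (n′ ∸ k′) + n′
  upper = Coding.upper-bound G simple acyclic components core
  extremal⇒star : m ≡ 2 ^ (n′ ∸ k′) + n′ → G ≅ starForest (suc n′) (suc k′)
  extremal⇒star = Extremal.isomorphic G simple k≤n acyclic components core
  star⇒extremal : G ≅ starForest (suc n′) (suc k′) → m ≡ 2 ^ (n′ ∸ k′) + n′
  star⇒extremal iso = ℕP.≤-antisym upper (StarForestSubgraphs.core-≥ G k≤n iso core)
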